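{- If $G$ is a partial cube and $u\in V(G)$, then $C_G(x)\le W_{G,u}(x+1)$, i.e. for every $k\ge0$ the coefficient of $x^k$ in $C_G(x)$ is at most the coefficient of $x^k$ in the polynomial $W_{G,u}(x+1)$.
   Context: A partial cube is a graph isomorphic to an isometric subgraph of some hypercube $Q_n$. For a graph $G$: $C_G(x)=\sum_{k\ge0}c_kx^k$, where $c_k$ is the number of induced subgraphs of $G$ isomorphic to the hypercube $Q_k$; for $u\in V(G)$, $W_{G,u}(x)=\sum_{d\ge0}w_dx^d$, where $w_d$ is the number of vertices of $G$ at distance $d$ from $u$. For polynomials $P,Q$, $P\le Q$ means coefficientwise inequality. -}

module Defs where

open import Data.Bool using (Bool; true; false; _∧_; _∨_; not; if_then_else_)
open import Data.Nat using (ℕ; zero; suc; _+_; _*_; _^_; _≡ᵇ_)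
open import Data.Nat.Combinatorics using (_C_)
open import Data.Fin using (Fin; _≟_)
open import Data.Vec using (Vec; []; _∷_; lookup)
open import Data.List using (List; []; _∷_; map; concatMap; filter; length; upTo; allFin)
open import Data.Bool.ListAction using (any; all)
open import Data.Nat.ListAction using (sum)
open import Relation.Nullary.Decidable using (⌊_⌋)
open import Relation.Binary.PropositionalEquality using (_≡_)

record Graph : Set where
  field
    n      : ℕ
    adj    : Fin n → Fin n → Bool
    sym    : ∀ i j → adj i j ≡ adj j i
    irrefl : ∀ i → adj i i ≡ false
open Graph public

_==_ : ∀ {m} → Fin m → Fin m → Bool
i == j = ⌊ i ≟ j ⌋

reach : (G : Graph) → Fin (n G) → ℕ → Fin (n G) → Bool
reach G u zero    v = u == v
reach G u (suc ℓ) v = reach G u ℓ v ∨ any (λ w → reach G u ℓ w ∧ adj G w v) (allFin (n G))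

atDist : (G : Graph) → Fin (n G) → Fin (n G) → ℕ → Bool
atDist G u v zero    = u == v
atDist G u v (suc d) = reach G u (suc d) v ∧ not (reach G u d v)

hamming : ∀ {m} → Vec Bool m → Vec Bool m → ℕ
hamming []       []       = 0
hamming (a ∷ as) (b ∷ bs) = (if a Data.Bool.xor b then 1 else 0) + hamming as bs

IsPartialCube : Graph → Set
IsPartialCube G =
  Data.Product.Σ ℕ λ m → Data.Product.Σ (Fin (n G) → Vec Bool m) λ f →
    ∀ u v → atDist G u v (hamming (f u) (f v)) ≡ true
  where import Data.Product

allVecsOver : ∀ {A : Set} → List A → (m : ℕ) → List (Vec A m)
allVecsOver xs zero    = [] ∷ []
allVecsOver xs (suc m) = concatMap (λ x → map (x ∷_) (allVecsOver xs m)) xs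

allWords : (m : ℕ) → List (Vec Bool m)
allWords = allVecsOver (true ∷ false ∷ [])

wordEq : ∀ {m} → Vec Bool m → Vec Bool m → Bool
wordEq a b = hamming a b ≡ᵇ 0

card : ∀ {m} → Vec Bool m → ℕ
card []           = 0
card (true ∷ s)   = suc (card s)
card (false ∷ s)  = card s

-- φ restricted to S is an isomorphism G[S] ≅ Q_k:
-- |S| = 2^k, φ injective on S (hence a bijection S → {0,1}^k), and
-- for i,j ∈ S: i ~ j in G  iff  φ i, φ j are adjacent in Q_k.
isCubeIso : (G : Graph) (k : ℕ) → Vec Bool (n G) → Vec (Vec Bool k) (n G) → Bool
isCubeIso G k S φ =
  (card S ≡ᵇ 2 ^ k) ∧
  all (λ i → all (λ j →
        not (lookup S i ∧ lookup S j) ∨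
          ((not (wordEq (lookup φ i) (lookup φ j)) ∨ (i == j)) ∧
           (if adj G i j then hamming (lookup φ i) (lookup φ j) ≡ᵇ 1
                         else not (hamming (lookup φ i) (lookup φ j) ≡ᵇ 1))))
      (allFin (n G))) (allFin (n G))

inducesCube : (G : Graph) (k : ℕ) → Vec Bool (n G) → Bool
inducesCube G k S = any (isCubeIso G k S) (allVecsOver (allWords k) (n G))

cubeCoeff : Graph → ℕ → ℕ
cubeCoeff G k = length (filter (λ S → inducesCube G k S Data.Bool.≟ true) (allWords (n G)))
  where import Data.Bool

distCount : (G : Graph) → Fin (n G) → ℕ → ℕ
distCount G u d = length (filter (λ v → atDist G u v d Data.Bool.≟ true) (allFin (n G)))
  where import Data.Bool

-- coefficient of x^k in W_{G,u}(x+1) = Σ_d w_d (x+1)^d, i.e. Σ_d w_d·C(d,k).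
-- Distances are < |V(G)|, so summing d over 0..|V(G)| covers all nonzero w_d.
shiftedWienerCoeff : (G : Graph) → Fin (n G) → ℕ → ℕ
shiftedWienerCoeff G u k = sum (map (λ d → distCount G u d * (d C k)) (upTo (suc (n G))))

-- Fix an isometric embedding f : V(G) → Q_m. If S induces a k-cube in G and v ∈ S, then f maps S
-- onto the subcube of Q_m through f v spanned by the k coordinates D along which S varies; this is
-- proved by induction on the distance from v inside the cube, using that in Q_m a vertex adjacent
-- to p + eᵢ and p + eⱼ (i ≠ j) is p or p + eᵢ + eⱼ. Choosing v as the vertex of S farthest from u
-- forces every coordinate of D to separate f u from f v, so D is a k-subset of the d(u, v)
-- coordinates where f u and f v differ. Since S is recovered from (v, D), S ↦ (v, D) is injective,
-- and there are Σ_v C(d(u, v), k) = Σ_d w_d C(d, k) such pairs.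

module Submission where

open import Defs hiding (sym)
open import Data.Bool using (Bool; true; false; _∧_; _∨_; not; _xor_; if_then_else_)
import Data.Bool as Bool
open import Data.Bool.ListAction using (any; all)
open import Data.Bool.Properties
  using ( T-≡; ⇔→≡; not-¬; ¬-not; not-involutive; not-distribˡ-xor; not-distribʳ-xor
        ; xor-assoc; xor-comm; xor-same; xor-identityʳ )
open import Data.Fin using (Fin; zero; suc; toℕ)
import Data.Fin.Properties as Finₚ
open import Data.List using (List; []; _∷_; map; concatMap; filter; length; upTo; allFin; _++_)
open import Data.List.Extrema.Nat using (argmax; argmax-sel; f[⊥]≤f[argmax]; f[xs]≤f[argmax])
open import Data.List.Membership.Propositional using (_∈_; find; lose)
open import Data.List.Membership.Propositional.Properties
open import Data.List.Properties using (length-++; length-map; length-tabulate; map-cong)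
open import Data.List.Relation.Binary.Subset.Propositional using (_⊆_)
open import Data.List.Relation.Unary.All as All using (All)
open import Data.List.Relation.Unary.All.Properties using (all⁺)
open import Data.List.Relation.Unary.Any as Any using (here; there)
open import Data.List.Relation.Unary.Any.Properties using (any⁺; any⁻)
open import Data.List.Relation.Unary.Unique.Propositional using (Unique; []; _∷_)
import Data.List.Relation.Unary.Unique.Propositional.Properties as Unique
open import Data.Nat
  using (ℕ; zero; suc; _+_; _*_; _^_; _≤_; _<_; z≤n; s≤s; _≤′_; ≤′-refl; ≤′-step; _≡ᵇ_)
open import Data.Nat.Combinatorics using (_C_; nCk+nC[k+1]≡[n+1]C[k+1])
open import Data.Nat.ListAction using (sum)
open import Data.Nat.Properties
open import Algebra.Properties.CommutativeSemigroup +-commutativeSemigroup using (interchange)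
open import Data.Product using (∃-syntax; ∃₂; _×_; _,_; proj₁; proj₂)
open import Data.Sum using (_⊎_; inj₁; inj₂)
open import Data.Vec using (Vec; []; _∷_; lookup; tabulate; zipWith; updateAt)
open import Data.Vec.Properties
  using ( ≡-dec; lookup∘tabulate; tabulate∘lookup; tabulate-cong; ∷-injectiveʳ; lookup-zipWith
        ; lookup∘updateAt; lookup∘updateAt′ )
open import Function using (_∘_; id; _⇔_; mk⇔; Equivalence)
open import Relation.Binary using (DecidableEquality)
open import Relation.Binary.PropositionalEquality
open import Relation.Nullary using (¬_; Dec; yes; no; contradiction)
open import Relation.Nullary.Decidable using (isYes≗does; dec-true; dec-false; toWitness)

open Equivalence using (to; from)

private
  variable
    A B : Set
    k m : ℕ

∧-≡true⁻ : ∀ {x y} → x ∧ y ≡ true → x ≡ true × y ≡ true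
∧-≡true⁻ {true} y≡true = refl , y≡true

∨-≡true⁻ʳ : ∀ {x y} → x ∨ y ≡ true → x ≢ true → y ≡ true
∨-≡true⁻ʳ {true}  _      x≢true = contradiction refl x≢true
∨-≡true⁻ʳ {false} y≡true _      = y≡true

not≡true⇒≢true : ∀ {x} → not x ≡ true → x ≢ true
not≡true⇒≢true {false} _ ()

==-refl : ∀ {n} (i : Fin n) → (i == i) ≡ true
==-refl i = trans (isYes≗does (i Finₚ.≟ i)) (dec-true (i Finₚ.≟ i) refl)

≢⇒==false : ∀ {n} {i j : Fin n} → i ≢ j → (i == j) ≡ false
≢⇒==false {i = i} {j} i≢j = trans (isYes≗does (i Finₚ.≟ j)) (dec-false (i Finₚ.≟ j) i≢j)

==⇒≡ : ∀ {n} {i j : Fin n} → (i == j) ≡ true → i ≡ j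
==⇒≡ i==j = toWitness (T-≡ .from i==j)

xor-cancelˡ : ∀ x y → x xor (x xor y) ≡ y
xor-cancelˡ x y = trans (sym (xor-assoc x x y)) (cong (_xor y) (xor-same x))

xor-cancelʳ : ∀ x y → (x xor y) xor y ≡ x
xor-cancelʳ x y = trans (xor-assoc x y y) (trans (cong (x xor_) (xor-same y)) (xor-identityʳ x))

xor-not-middle : ∀ x y z → x xor (not y xor z) ≡ not (x xor (y xor z))
xor-not-middle x y z = trans (cong (x xor_) (sym (not-distribˡ-xor y z))) (sym (not-distribʳ-xor x (y xor z)))

≢⇒xor≡true : ∀ {x y} → x ≢ y → x xor y ≡ true
≢⇒xor≡true {true}  {true}  x≢y = contradiction refl x≢y
≢⇒xor≡true {true}  {false} _   = refl
≢⇒xor≡true {false} {true}  _   = refl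
≢⇒xor≡true {false} {false} x≢y = contradiction refl x≢y

xor≡true⇒≢ : ∀ {x y} → x xor y ≡ true → x ≢ y
xor≡true⇒≢ {true}  () refl
xor≡true⇒≢ {false} () refl

any-≡true⁺ : (p : A → Bool) {xs : List A} {x : A} → x ∈ xs → p x ≡ true → any p xs ≡ true
any-≡true⁺ p x∈xs px = T-≡ .to (any⁺ p (lose x∈xs (T-≡ .from px)))

any-≡true⁻ : (p : A → Bool) (xs : List A) → any p xs ≡ true → ∃[ x ] x ∈ xs × p x ≡ true
any-≡true⁻ p xs any≡true with x , x∈xs , px ← find (any⁻ p xs (T-≡ .from any≡true)) =
  x , x∈xs , T-≡ .to px

all-≡true⁻ : (p : A → Bool) {xs : List A} {x : A} → all p xs ≡ true → x ∈ xs → p x ≡ true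
all-≡true⁻ p {xs} all≡true x∈xs = T-≡ .to (All.lookup (all⁺ p xs (T-≡ .from all≡true)) x∈xs)

length-concatMap : (f : A → List B) (xs : List A) → length (concatMap f xs) ≡ sum (map (length ∘ f) xs)
length-concatMap f []       = refl
length-concatMap f (x ∷ xs) = trans (length-++ (f x)) (cong (length (f x) +_) (length-concatMap f xs))

sum-map-const : (F : A → ℕ) {c : ℕ} (xs : List A) → (∀ {x} → x ∈ xs → F x ≡ c) →
                sum (map F xs) ≡ length xs * c
sum-map-const F []       _     = refl
sum-map-const F (x ∷ xs) F≡c = cong₂ _+_ (F≡c (here refl)) (sum-map-const F xs (F≡c ∘ there))

length-middle : (ys : List A) {y : A} {zs : List A} → length (ys ++ y ∷ zs) ≡ suc (length (ys ++ zs))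
length-middle ys {y} {zs} = begin
  length (ys ++ y ∷ zs)        ≡⟨ length-++ ys ⟩
  length ys + suc (length zs)  ≡⟨ +-suc (length ys) (length zs) ⟩
  suc (length ys + length zs)  ≡⟨ cong suc (length-++ ys) ⟨
  suc (length (ys ++ zs))      ∎
  where open ≡-Reasoning

∈-middle⁻ : (ys : List A) {x y : A} {zs : List A} → x ∈ ys ++ y ∷ zs → x ≢ y → x ∈ ys ++ zs
∈-middle⁻ ys x∈ x≢y with ∈-++⁻ ys x∈
... | inj₁ x∈ys         = ∈-++⁺ˡ x∈ys
... | inj₂ (here x≡y)   = contradiction x≡y x≢y
... | inj₂ (there x∈zs) = ∈-++⁺ʳ ys x∈zs

InjectiveOn : (A → B) → List A → Set
InjectiveOn g xs = ∀ {x y} → x ∈ xs → y ∈ xs → g x ≡ g y → x ≡ y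

injectiveOn⇒length≤ : (g : A → B) {xs : List A} {ys : List B} → Unique xs → InjectiveOn g xs →
                      (∀ {x} → x ∈ xs → g x ∈ ys) → length xs ≤ length ys
injectiveOn⇒length≤ g {[]}     _             _   _  = z≤n
injectiveOn⇒length≤ g {x ∷ xs} (x∉xs ∷ !xs) inj g∈
  with ys₁ , ys₂ , refl ← ∈-∃++ (g∈ (here refl)) =
  ≤-trans (s≤s (injectiveOn⇒length≤ g !xs (λ p q → inj (there p) (there q)) g∈′))
          (≤-reflexive (sym (length-middle ys₁)))
  where
  g∈′ : ∀ {y} → y ∈ xs → g y ∈ ys₁ ++ ys₂
  g∈′ y∈xs = ∈-middle⁻ ys₁ (g∈ (there y∈xs))
    (λ gy≡gx → All.lookup x∉xs y∈xs (inj (here refl) (there y∈xs) (sym gy≡gx)))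

injectiveOn⇒surjective : DecidableEquality B → (g : A → B) {xs : List A} {ys : List B} → Unique xs →
                         InjectiveOn g xs → (∀ {x} → x ∈ xs → g x ∈ ys) → length ys ≤ length xs →
                         ∀ {y} → y ∈ ys → ∃[ x ] x ∈ xs × g x ≡ y
injectiveOn⇒surjective _≟_ g {xs} !xs inj g∈ ys≤xs {y} y∈ys with Any.any? (λ x → g x ≟ y) xs
... | yes hit = find hit
... | no miss with ys₁ , ys₂ , refl ← ∈-∃++ y∈ys =
  contradiction (injectiveOn⇒length≤ g !xs inj g∈′)
                (<⇒≱ (subst (_≤ length xs) (length-middle ys₁) ys≤xs))
  where
  g∈′ : ∀ {x} → x ∈ xs → g x ∈ ys₁ ++ ys₂
  g∈′ x∈xs = ∈-middle⁻ ys₁ (g∈ x∈xs) (miss ∘ lose x∈xs)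

⊆-antisym⇒length≡ : {xs ys : List A} → Unique xs → Unique ys → xs ⊆ ys → ys ⊆ xs →
                    length xs ≡ length ys
⊆-antisym⇒length≡ !xs !ys xs⊆ys ys⊆xs =
  ≤-antisym (injectiveOn⇒length≤ id !xs (λ _ _ → id) xs⊆ys)
            (injectiveOn⇒length≤ id !ys (λ _ _ → id) ys⊆xs)

-- Boolean vectors as subsets

infix 4 _∈ₛ_ _⊆ₛ_

_∈ₛ_ : ∀ {n} → Fin n → Vec Bool n → Set
i ∈ₛ S = lookup S i ≡ true

_⊆ₛ_ : ∀ {n} → Vec Bool n → Vec Bool n → Set
S ⊆ₛ S′ = ∀ {i} → i ∈ₛ S → i ∈ₛ S′

pointwise⇒≡ : ∀ {n} {a b : Vec A n} → (∀ i → lookup a i ≡ lookup b i) → a ≡ b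
pointwise⇒≡ {a = a} {b} a≗b = begin
  a                  ≡⟨ tabulate∘lookup a ⟨
  tabulate (lookup a) ≡⟨ tabulate-cong a≗b ⟩
  tabulate (lookup b) ≡⟨ tabulate∘lookup b ⟩
  b                  ∎
  where open ≡-Reasoning

⊆ₛ-antisym : ∀ {n} {S S′ : Vec Bool n} → S ⊆ₛ S′ → S′ ⊆ₛ S → S ≡ S′
⊆ₛ-antisym S⊆S′ S′⊆S = pointwise⇒≡ λ _ → ⇔→≡ (mk⇔ S⊆S′ S′⊆S)

members : ∀ {n} → Vec Bool n → List (Fin n)
members []          = []
members (true  ∷ S) = zero ∷ map suc (members S)
members (false ∷ S) = map suc (members S)

length-members : ∀ {n} (S : Vec Bool n) → length (members S) ≡ card S
length-members []          = refl
length-members (true  ∷ S) = cong suc (trans (length-map suc (members S)) (length-members S))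
length-members (false ∷ S) = trans (length-map suc (members S)) (length-members S)

members-unique : ∀ {n} (S : Vec Bool n) → Unique (members S)
members-unique []          = []
members-unique (true  ∷ S) = zero∉map-suc (members S) ∷ Unique.map⁺ Finₚ.suc-injective (members-unique S)
  where
  zero∉map-suc : ∀ {n} (is : List (Fin n)) → All (λ (i : Fin (suc n)) → zero ≢ i) (map suc is)
  zero∉map-suc []       = All.[]
  zero∉map-suc (_ ∷ is) = (λ ()) All.∷ zero∉map-suc is
members-unique (false ∷ S) = Unique.map⁺ Finₚ.suc-injective (members-unique S)

∈-members⁺ : ∀ {n} (S : Vec Bool n) {i} → i ∈ₛ S → i ∈ members S
∈-members⁺ (true  ∷ S) {zero}  _   = here refl
∈-members⁺ (true  ∷ S) {suc i} i∈S = there (∈-map⁺ suc (∈-members⁺ S i∈S))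
∈-members⁺ (false ∷ S) {suc i} i∈S = ∈-map⁺ suc (∈-members⁺ S i∈S)

∈-members⁻ : ∀ {n} (S : Vec Bool n) {i} → i ∈ members S → i ∈ₛ S
∈-members⁻ (true  ∷ S) (here refl) = refl
∈-members⁻ (true  ∷ S) (there i∈)  with _ , j∈ , refl ← ∈-map⁻ suc i∈ = ∈-members⁻ S j∈
∈-members⁻ (false ∷ S) i∈          with _ , j∈ , refl ← ∈-map⁻ suc i∈ = ∈-members⁻ S j∈

card-injective-image : ∀ {n} {W : Vec Bool n} (g : Fin k → Fin n) →
                       (∀ {i i′} → g i ≡ g i′ → i ≡ i′) →
                       (∀ {j} → j ∈ₛ W ⇔ (∃[ i ] g i ≡ j)) → card W ≡ k
card-injective-image {k = k} {W = W} g g-injective ∈W⇔ = begin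
  card W                     ≡⟨ length-members W ⟨
  length (members W)
    ≡⟨ ⊆-antisym⇒length≡ (members-unique W) image-unique members⊆image image⊆members ⟩
  length (map g (allFin k))  ≡⟨ length-map g (allFin k) ⟩
  length (allFin k)          ≡⟨ length-tabulate id ⟩
  k                          ∎
  where
  open ≡-Reasoning
  image-unique : Unique (map g (allFin k))
  image-unique = Unique.map⁺ g-injective (Unique.allFin⁺ k)
  members⊆image : members W ⊆ map g (allFin k)
  members⊆image j∈ with i , refl ← ∈W⇔ .to (∈-members⁻ W j∈) = ∈-map⁺ g (∈-allFin i)
  image⊆members : map g (allFin k) ⊆ members W
  image⊆members j∈ with i , _ , refl ← ∈-map⁻ g j∈ = ∈-members⁺ W (∈W⇔ .from (i , refl))

allWords-complete : (w : Vec Bool m) → w ∈ allWords m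
allWords-complete []          = here refl
allWords-complete (true  ∷ w) = ∈-++⁺ˡ (∈-map⁺ (true ∷_) (allWords-complete w))
allWords-complete {suc m} (false ∷ w) =
  ∈-++⁺ʳ (map (true ∷_) (allWords m)) (∈-++⁺ˡ (∈-map⁺ (false ∷_) (allWords-complete w)))

allWords-unique : ∀ m → Unique (allWords m)
allWords-unique zero    = All.[] ∷ []
allWords-unique (suc m) =
  Unique.++⁺ (words-with true) (Unique.++⁺ (words-with false) [] λ ()) disjoint
  where
  words-with : ∀ b → Unique (map (b ∷_) (allWords m))
  words-with b = Unique.map⁺ ∷-injectiveʳ (allWords-unique m)
  disjoint : ∀ {w} → ¬ (w ∈ map (true ∷_) (allWords m) × w ∈ map (false ∷_) (allWords m) ++ [])
  disjoint (w∈t , w∈f)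
    with _ , _ , refl ← ∈-map⁻ (true ∷_) w∈t | ∈-++⁻ (map (false ∷_) (allWords m)) w∈f
  ... | inj₁ w∈f′ with () ← ∈-map⁻ (false ∷_) w∈f′

length-allWords : ∀ m → length (allWords m) ≡ 2 ^ m
length-allWords zero    = refl
length-allWords (suc m) =
  trans (length-concatMap (λ b → map (b ∷_) (allWords m)) (true ∷ false ∷ []))
        (cong₂ _+_ (words-with true) (cong (_+ 0) (words-with false)))
  where
  words-with : ∀ b → length (map (b ∷_) (allWords m)) ≡ 2 ^ m
  words-with b = trans (length-map (b ∷_) (allWords m)) (length-allWords m)

subsetsOfSize : Vec Bool m → ℕ → List (Vec Bool m)
subsetsOfSize []          zero    = [] ∷ []
subsetsOfSize []          (suc k) = []
subsetsOfSize (true  ∷ M) zero    = map (false ∷_) (subsetsOfSize M zero)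
subsetsOfSize (true  ∷ M) (suc k) =
  map (true ∷_) (subsetsOfSize M k) ++ map (false ∷_) (subsetsOfSize M (suc k))
subsetsOfSize (false ∷ M) k       = map (false ∷_) (subsetsOfSize M k)

length-subsetsOfSize : (M : Vec Bool m) (k : ℕ) → length (subsetsOfSize M k) ≡ card M C k
length-subsetsOfSize []          zero    = refl
length-subsetsOfSize []          (suc k) = refl
length-subsetsOfSize (true  ∷ M) zero    =
  trans (length-map _ (subsetsOfSize M zero)) (length-subsetsOfSize M zero)
length-subsetsOfSize (true  ∷ M) (suc k) = begin
  length (map (true ∷_) (subsetsOfSize M k) ++ map (false ∷_) (subsetsOfSize M (suc k)))
    ≡⟨ length-++ (map (true ∷_) (subsetsOfSize M k)) ⟩
  length (map (true ∷_) (subsetsOfSize M k)) + length (map (false ∷_) (subsetsOfSize M (suc k)))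
    ≡⟨ cong₂ _+_ (length-map _ (subsetsOfSize M k)) (length-map _ (subsetsOfSize M (suc k))) ⟩
  length (subsetsOfSize M k) + length (subsetsOfSize M (suc k))
    ≡⟨ cong₂ _+_ (length-subsetsOfSize M k) (length-subsetsOfSize M (suc k)) ⟩
  card M C k + card M C suc k
    ≡⟨ nCk+nC[k+1]≡[n+1]C[k+1] (card M) k ⟩
  suc (card M) C suc k ∎
  where open ≡-Reasoning
length-subsetsOfSize (false ∷ M) k       = trans (length-map _ (subsetsOfSize M k)) (length-subsetsOfSize M k)

∈-subsetsOfSize : {W M : Vec Bool m} → W ⊆ₛ M → W ∈ subsetsOfSize M (card W)
∈-subsetsOfSize {W = []}        {[]}        _   = here refl
∈-subsetsOfSize {W = true  ∷ W} {true  ∷ M} W⊆M =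
  ∈-++⁺ˡ (∈-map⁺ (true ∷_) (∈-subsetsOfSize {W = W} {M} (λ {i} → W⊆M {suc i})))
∈-subsetsOfSize {W = true  ∷ W} {false ∷ M} W⊆M with () ← W⊆M {zero} refl
∈-subsetsOfSize {W = false ∷ W} {false ∷ M} W⊆M =
  ∈-map⁺ (false ∷_) (∈-subsetsOfSize {W = W} {M} (λ {i} → W⊆M {suc i}))
∈-subsetsOfSize {W = false ∷ W} {true  ∷ M} W⊆M
  with card W | ∈-subsetsOfSize {W = W} {M} (λ {i} → W⊆M {suc i})
... | zero  | W∈ = ∈-map⁺ (false ∷_) W∈
... | suc k | W∈ = ∈-++⁺ʳ (map (true ∷_) (subsetsOfSize M k)) (∈-map⁺ (false ∷_) W∈)

-- Hamming geometry of Q_m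

infixl 6 _⊕_

_⊕_ : Vec Bool m → Vec Bool m → Vec Bool m
_⊕_ = zipWith _xor_

∈-⊕⁺ : (a b : Vec Bool m) {j : Fin m} → lookup a j ≢ lookup b j → j ∈ₛ a ⊕ b
∈-⊕⁺ a b {j} aj≢bj = trans (lookup-zipWith _xor_ j a b) (≢⇒xor≡true aj≢bj)

∈-⊕⁻ : (a b : Vec Bool m) {j : Fin m} → j ∈ₛ a ⊕ b → lookup a j ≢ lookup b j
∈-⊕⁻ a b {j} j∈a⊕b = xor≡true⇒≢ (trans (sym (lookup-zipWith _xor_ j a b)) j∈a⊕b)

card-⊕ : (a b : Vec Bool m) → card (a ⊕ b) ≡ hamming a b
card-⊕ []          []          = refl
card-⊕ (true  ∷ a) (true  ∷ b) = card-⊕ a b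
card-⊕ (true  ∷ a) (false ∷ b) = cong suc (card-⊕ a b)
card-⊕ (false ∷ a) (true  ∷ b) = cong suc (card-⊕ a b)
card-⊕ (false ∷ a) (false ∷ b) = card-⊕ a b

hamming-self : (a : Vec Bool m) → hamming a a ≡ 0
hamming-self []          = refl
hamming-self (true  ∷ a) = hamming-self a
hamming-self (false ∷ a) = hamming-self a

hamming≡0⇒≡ : (a b : Vec Bool m) → hamming a b ≡ 0 → a ≡ b
hamming≡0⇒≡ []          []          _ = refl
hamming≡0⇒≡ (true  ∷ a) (true  ∷ b) e = cong (true ∷_) (hamming≡0⇒≡ a b e)
hamming≡0⇒≡ (false ∷ a) (false ∷ b) e = cong (false ∷_) (hamming≡0⇒≡ a b e)

hamming-sym : (a b : Vec Bool m) → hamming a b ≡ hamming b a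
hamming-sym a b = begin
  hamming a b    ≡⟨ card-⊕ a b ⟨
  card (a ⊕ b)   ≡⟨ cong card (pointwise⇒≡ {a = a ⊕ b} {b ⊕ a} ⊕-comm) ⟩
  card (b ⊕ a)   ≡⟨ card-⊕ b a ⟩
  hamming b a    ∎
  where
  open ≡-Reasoning
  ⊕-comm : ∀ j → lookup (a ⊕ b) j ≡ lookup (b ⊕ a) j
  ⊕-comm j = trans (lookup-zipWith _xor_ j a b)
                   (trans (xor-comm (lookup a j) (lookup b j)) (sym (lookup-zipWith _xor_ j b a)))

hamming-triangle : (a b c : Vec Bool m) → hamming a c ≤ hamming a b + hamming b c
hamming-triangle []      []      []      = z≤n
hamming-triangle (x ∷ a) (y ∷ b) (z ∷ c) = begin
  δ x z + hamming a c
    ≤⟨ +-mono-≤ (δ-triangle x y z) (hamming-triangle a b c) ⟩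
  (δ x y + δ y z) + (hamming a b + hamming b c)
    ≡⟨ interchange (δ x y) (δ y z) (hamming a b) (hamming b c) ⟩
  (δ x y + hamming a b) + (δ y z + hamming b c) ∎
  where
  open ≤-Reasoning
  δ : Bool → Bool → ℕ
  δ x y = if x xor y then 1 else 0
  δ-triangle : ∀ x y z → δ x z ≤ δ x y + δ y z
  δ-triangle true  true  z     = m≤n+m (δ true z) 0
  δ-triangle false false z     = ≤-refl
  δ-triangle true  false true  = z≤n
  δ-triangle true  false false = s≤s z≤n
  δ-triangle false true  true  = s≤s z≤n
  δ-triangle false true  false = z≤n

toggle : Vec Bool m → Fin m → Vec Bool m
toggle w j = updateAt w j not

lookup-toggle : (w : Vec Bool m) (j : Fin m) → lookup (toggle w j) j ≡ not (lookup w j)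
lookup-toggle w j = lookup∘updateAt j w

lookup-toggle-≢ : (w : Vec Bool m) {i j : Fin m} → i ≢ j → lookup (toggle w j) i ≡ lookup w i
lookup-toggle-≢ w {i} {j} i≢j = lookup∘updateAt′ i j i≢j w

toggle-changes : (w : Vec Bool m) (j : Fin m) → lookup (toggle w j) j ≢ lookup w j
toggle-changes w j = not-¬ refl ∘ sym ∘ trans (sym (lookup-toggle w j))

toggle-involutive : (w : Vec Bool m) (j : Fin m) → toggle (toggle w j) j ≡ w
toggle-involutive (x ∷ w) zero    = cong (_∷ w) (not-involutive x)
toggle-involutive (x ∷ w) (suc j) = cong (x ∷_) (toggle-involutive w j)

toggle-injectiveʳ : (w : Vec Bool m) {i j : Fin m} → toggle w i ≡ toggle w j → i ≡ j
toggle-injectiveʳ w {i} {j} wᵢ≡wⱼ with i Finₚ.≟ j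
... | yes i≡j = i≡j
... | no  i≢j =
  contradiction (trans (cong (λ w′ → lookup w′ i) wᵢ≡wⱼ) (lookup-toggle-≢ w i≢j)) (toggle-changes w i)

hamming-toggle-≡ : (a b : Vec Bool m) {j : Fin m} → lookup a j ≡ lookup b j →
                   hamming a (toggle b j) ≡ suc (hamming a b)
hamming-toggle-≡ (true  ∷ a) (true  ∷ b) {zero}  _ = refl
hamming-toggle-≡ (false ∷ a) (false ∷ b) {zero}  _ = refl
hamming-toggle-≡ (x     ∷ a) (y     ∷ b) {suc j} e =
  trans (cong ((if x xor y then 1 else 0) +_) (hamming-toggle-≡ a b e)) (+-suc _ _)

hamming-toggle-≢ : (a b : Vec Bool m) {j : Fin m} → lookup a j ≢ lookup b j →
                   suc (hamming a (toggle b j)) ≡ hamming a b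
hamming-toggle-≢ (true  ∷ a) (true  ∷ b) {zero}  ne = contradiction refl ne
hamming-toggle-≢ (false ∷ a) (false ∷ b) {zero}  ne = contradiction refl ne
hamming-toggle-≢ (true  ∷ a) (false ∷ b) {zero}  _  = refl
hamming-toggle-≢ (false ∷ a) (true  ∷ b) {zero}  _  = refl
hamming-toggle-≢ (x     ∷ a) (y     ∷ b) {suc j} ne =
  trans (sym (+-suc _ _)) (cong ((if x xor y then 1 else 0) +_) (hamming-toggle-≢ a b ne))

hamming-toggle : (a : Vec Bool m) (j : Fin m) → hamming a (toggle a j) ≡ 1
hamming-toggle a j = trans (hamming-toggle-≡ a a refl) (cong suc (hamming-self a))

hamming≡1⇒toggle : (a b : Vec Bool m) → hamming a b ≡ 1 → ∃[ j ] b ≡ toggle a j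
hamming≡1⇒toggle []          []          ()
hamming≡1⇒toggle (true  ∷ a) (true  ∷ b) e with j , b≡ ← hamming≡1⇒toggle a b e = suc j , cong (true ∷_) b≡
hamming≡1⇒toggle (false ∷ a) (false ∷ b) e with j , b≡ ← hamming≡1⇒toggle a b e = suc j , cong (false ∷_) b≡
hamming≡1⇒toggle (true  ∷ a) (false ∷ b) e = zero , cong (false ∷_) (sym (hamming≡0⇒≡ a b (suc-injective e)))
hamming≡1⇒toggle (false ∷ a) (true  ∷ b) e = zero , cong (true ∷_)  (sym (hamming≡0⇒≡ a b (suc-injective e)))

hamming≡suc⇒disagree : (a b : Vec Bool m) {e : ℕ} → hamming a b ≡ suc e →
                        ∃[ j ] lookup a j ≢ lookup b j
hamming≡suc⇒disagree []          []          ()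
hamming≡suc⇒disagree (true  ∷ a) (false ∷ b) _ = zero , λ ()
hamming≡suc⇒disagree (false ∷ a) (true  ∷ b) _ = zero , λ ()
hamming≡suc⇒disagree (true  ∷ a) (true  ∷ b) h with j , ne ← hamming≡suc⇒disagree a b h = suc j , ne
hamming≡suc⇒disagree (false ∷ a) (false ∷ b) h with j , ne ← hamming≡suc⇒disagree a b h = suc j , ne

hamming≡2+⇒two-disagreements : (a b : Vec Bool m) {e : ℕ} → hamming a b ≡ suc (suc e) →
  ∃₂ λ i j → i ≢ j × lookup a i ≢ lookup b i × lookup a j ≢ lookup b j
hamming≡2+⇒two-disagreements a b h
  with i , aᵢ≢bᵢ ← hamming≡suc⇒disagree a b h
  with j , aⱼ≢b′ⱼ ← hamming≡suc⇒disagree a (toggle b i)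
                       (suc-injective (trans (hamming-toggle-≢ a b aᵢ≢bᵢ) h)) =
  i , j , i≢j , aᵢ≢bᵢ , aⱼ≢bⱼ
  where
  i≢j : i ≢ j
  i≢j refl = aⱼ≢b′ⱼ (trans (¬-not aᵢ≢bᵢ) (sym (lookup-toggle b i)))
  aⱼ≢bⱼ : lookup a j ≢ lookup b j
  aⱼ≢bⱼ = subst (lookup a j ≢_) (lookup-toggle-≢ b (i≢j ∘ sym)) aⱼ≢b′ⱼ

common-neighbours : (p q : Vec Bool m) {i j : Fin m} → i ≢ j →
  hamming q (toggle p i) ≡ 1 → hamming q (toggle p j) ≡ 1 → q ≡ p ⊎ q ≡ toggle (toggle p i) j
common-neighbours p q {i} {j} i≢j qᵢ qⱼ
  with hamming≡1⇒toggle (toggle p i) q (trans (hamming-sym (toggle p i) q) qᵢ)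
... | l , refl with l Finₚ.≟ i | l Finₚ.≟ j
... | yes refl | _        = inj₁ (toggle-involutive p i)
... | no _     | yes refl = inj₂ refl
... | no l≢i   | no l≢j   = contradiction (trans (sym distance≡3) qⱼ) λ ()
  where
  open ≡-Reasoning
  distance≡3 : hamming (toggle (toggle p i) l) (toggle p j) ≡ 3
  distance≡3 = begin
    hamming (toggle (toggle p i) l) (toggle p j) ≡⟨ hamming-sym (toggle (toggle p i) l) (toggle p j) ⟩
    hamming (toggle p j) (toggle (toggle p i) l)
      ≡⟨ hamming-toggle-≡ (toggle p j) (toggle p i)
           (trans (lookup-toggle-≢ p l≢j) (sym (lookup-toggle-≢ p l≢i))) ⟩
    suc (hamming (toggle p j) (toggle p i))
      ≡⟨ cong suc (hamming-toggle-≡ (toggle p j) p (lookup-toggle-≢ p i≢j)) ⟩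
    suc (suc (hamming (toggle p j) p))           ≡⟨ cong (2 +_) (hamming-sym (toggle p j) p) ⟩
    suc (suc (hamming p (toggle p j)))           ≡⟨ cong (2 +_) (hamming-toggle p j) ⟩
    3                                            ∎

module Distance (G : Graph) where

  reach-suc : ∀ {u v ℓ} → reach G u ℓ v ≡ true → reach G u (suc ℓ) v ≡ true
  reach-suc r rewrite r = refl

  reach-mono : ∀ {u v ℓ ℓ′} → ℓ ≤ ℓ′ → reach G u ℓ v ≡ true → reach G u ℓ′ v ≡ true
  reach-mono ℓ≤ℓ′ = go (≤⇒≤′ ℓ≤ℓ′)
    where
    go : ∀ {u v ℓ ℓ′} → ℓ ≤′ ℓ′ → reach G u ℓ v ≡ true → reach G u ℓ′ v ≡ true
    go                 ≤′-refl          r = r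
    go {ℓ′ = suc ℓ′} (≤′-step ℓ≤′ℓ′) r = reach-suc {ℓ = ℓ′} (go ℓ≤′ℓ′ r)

  atDist⇒reach : ∀ {u v} d → atDist G u v d ≡ true → reach G u d v ≡ true
  atDist⇒reach zero    at = at
  atDist⇒reach (suc d) at = proj₁ (∧-≡true⁻ at)

  reach⇒atDist≤ : ∀ {u v ℓ} d → reach G u ℓ v ≡ true → atDist G u v d ≡ true → d ≤ ℓ
  reach⇒atDist≤         zero    _ _  = z≤n
  reach⇒atDist≤ {ℓ = ℓ} (suc d) r at with ℓ ≤? d
  ... | no  ℓ≰d = ≰⇒> ℓ≰d
  ... | yes ℓ≤d = contradiction (reach-mono ℓ≤d r) (not≡true⇒≢true (proj₂ (∧-≡true⁻ at)))

  atDist-functional : ∀ {u v} d d′ → atDist G u v d ≡ true → atDist G u v d′ ≡ true → d ≡ d′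
  atDist-functional d d′ at at′ =
    ≤-antisym (reach⇒atDist≤ d (atDist⇒reach d′ at′) at)
              (reach⇒atDist≤ d′ (atDist⇒reach d at) at′)

  adj⇒atDist≡1 : ∀ {u v} → adj G u v ≡ true → atDist G u v 1 ≡ true
  adj⇒atDist≡1 {u} {v} uv =
    cong₂ (λ x y → (x ∨ y) ∧ not x) (≢⇒==false u≢v)
          (any-≡true⁺ (λ w → (u == w) ∧ adj G w v) (∈-allFin u) uu∧uv)
    where
    u≢v : u ≢ v
    u≢v refl = not≡true⇒≢true (cong not (irrefl G u)) uv
    uu∧uv : (u == u) ∧ adj G u v ≡ true
    uu∧uv rewrite ==-refl u = uv

  atDist-suc⇒predecessor : ∀ {u v} d → atDist G u v (suc d) ≡ true →
                           ∃[ w ] reach G u d w ≡ true × adj G w v ≡ true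
  atDist-suc⇒predecessor {u} {v} d at
    with reached , unreached ← ∧-≡true⁻ {reach G u (suc d) v} at
    with w , _ , p ← any-≡true⁻ _ (allFin (n G))
                       (∨-≡true⁻ʳ {reach G u d v} reached (not≡true⇒≢true unreached)) =
    w , ∧-≡true⁻ p

module PartialCube {G : Graph} {m : ℕ} (f : Fin (n G) → Vec Bool m)
                   (isometric : ∀ u v → atDist G u v (hamming (f u) (f v)) ≡ true) where

  open Distance G

  dist : Fin (n G) → Fin (n G) → ℕ
  dist u v = hamming (f u) (f v)

  atDist⇒≡dist : ∀ {u v} d → atDist G u v d ≡ true → d ≡ dist u v
  atDist⇒≡dist {u} {v} d at = atDist-functional d (dist u v) at (isometric u v)

  f-injective : ∀ {u v} → f u ≡ f v → u ≡ v
  f-injective {u} {v} fu≡fv = ==⇒≡ (subst (λ d → atDist G u v d ≡ true) dist≡0 (isometric u v))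
    where
    dist≡0 : dist u v ≡ 0
    dist≡0 = trans (cong (hamming (f u)) (sym fu≡fv)) (hamming-self (f u))

  adj⇒dist≡1 : ∀ {u v} → adj G u v ≡ true → dist u v ≡ 1
  adj⇒dist≡1 uv = sym (atDist⇒≡dist 1 (adj⇒atDist≡1 uv))

  reach⇒dist≤ : ∀ {u v ℓ} → reach G u ℓ v ≡ true → dist u v ≤ ℓ
  reach⇒dist≤ {u} {v} r = reach⇒atDist≤ (dist u v) r (isometric u v)

  dist-predecessor : ∀ {u v d} → dist u v ≡ suc d → ∃[ w ] dist u w ≡ d
  dist-predecessor {u} {v} {d} uv≡1+d
    with w , uw , wv ← atDist-suc⇒predecessor d
                         (subst (λ d → atDist G u v d ≡ true) uv≡1+d (isometric u v)) =
    w , ≤-antisym (reach⇒dist≤ uw) (+-cancelʳ-≤ 1 d (dist u w) 1+d≤)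
    where
    open ≤-Reasoning
    1+d≤ : d + 1 ≤ dist u w + 1
    1+d≤ = begin
      d + 1                   ≡⟨ +-comm d 1 ⟩
      suc d                   ≡⟨ uv≡1+d ⟨
      dist u v                ≤⟨ hamming-triangle (f u) (f w) (f v) ⟩
      dist u w + dist w v     ≡⟨ cong (dist u w +_) (adj⇒dist≡1 wv) ⟩
      dist u w + 1            ∎

  dist-levels : ∀ {u v i} d → dist u v ≡ d → i ≤ d → ∃[ w ] dist u w ≡ i
  dist-levels {v = v} {i} d uv≡d i≤d with i ≟ d
  ... | yes refl = v , uv≡d
  dist-levels zero    _     i≤0 | no i≢0 = contradiction (n≤0⇒n≡0 i≤0) i≢0
  dist-levels (suc d) uv≡1+d i≤1+d | no i≢1+d =
    dist-levels d (proj₂ (dist-predecessor uv≡1+d)) (≤-pred (≤∧≢⇒< i≤1+d i≢1+d))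

  dist<n : ∀ u v → dist u v < n G
  dist<n u v = Finₚ.injective⇒≤ level-injective
    where
    level : Fin (suc (dist u v)) → Fin (n G)
    level i = proj₁ (dist-levels (dist u v) refl (Finₚ.toℕ≤pred[n] i))
    dist-level : ∀ i → dist u (level i) ≡ toℕ i
    dist-level i = proj₂ (dist-levels (dist u v) refl (Finₚ.toℕ≤pred[n] i))
    level-injective : ∀ {i j} → level i ≡ level j → i ≡ j
    level-injective {i} {j} eq =
      Finₚ.toℕ-injective (trans (sym (dist-level i)) (trans (cong (dist u) eq) (dist-level j)))

  directions : Vec Bool (n G) → Fin (n G) → Vec Bool m
  directions S v = tabulate λ j → any (λ x → lookup S x ∧ lookup (f x ⊕ f v) j) (allFin (n G))

  ∈-directions⁺ : ∀ {S x v j} → x ∈ₛ S → j ∈ₛ f x ⊕ f v → j ∈ₛ directions S v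
  ∈-directions⁺ {S} {x} {v} {j} x∈S j∈ =
    trans (lookup∘tabulate _ j)
          (any-≡true⁺ (λ x → lookup S x ∧ lookup (f x ⊕ f v) j) (∈-allFin x) (cong₂ _∧_ x∈S j∈))

  ∈-directions⁻ : ∀ {S v j} → j ∈ₛ directions S v → ∃[ x ] x ∈ₛ S × j ∈ₛ f x ⊕ f v
  ∈-directions⁻ {S} {v} {j} j∈
    with x , _ , p ← any-≡true⁻ _ (allFin (n G)) (trans (sym (lookup∘tabulate _ j)) j∈) =
    x , ∧-≡true⁻ p

  module InducedCube {k : ℕ} {S : Vec Bool (n G)} {φ : Vec (Vec Bool k) (n G)}
                     (cube : isCubeIso G k S φ ≡ true) where

    label : Fin (n G) → Vec Bool k
    label = lookup φ

    card≡2^k : card S ≡ 2 ^ k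
    card≡2^k = ≡ᵇ⇒≡ (card S) (2 ^ k) (T-≡ .from (proj₁ (∧-≡true⁻ cube)))

    private
      pair-condition : ∀ {x y} → x ∈ₛ S → y ∈ₛ S →
        (not (wordEq (label x) (label y)) ∨ (x == y)) ≡ true ×
        (if adj G x y then hamming (label x) (label y) ≡ᵇ 1
                      else not (hamming (label x) (label y) ≡ᵇ 1)) ≡ true
      pair-condition {x} {y} x∈S y∈S = ∧-≡true⁻ (∨-≡true⁻ʳ
        (all-≡true⁻ _ (all-≡true⁻ _ (proj₂ (∧-≡true⁻ cube)) (∈-allFin x)) (∈-allFin y))
        λ outside → not≡true⇒≢true outside (cong₂ _∧_ x∈S y∈S))

    label-injective : ∀ {x y} → x ∈ₛ S → y ∈ₛ S → label x ≡ label y → x ≡ y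
    label-injective {x} {y} x∈S y∈S lx≡ly =
      ==⇒≡ (∨-≡true⁻ʳ (proj₁ (pair-condition x∈S y∈S)) λ distinct →
              not≡true⇒≢true distinct same)
      where
      same : wordEq (label x) (label y) ≡ true
      same = cong (_≡ᵇ 0) (trans (cong (hamming (label x)) (sym lx≡ly)) (hamming-self (label x)))

    label-adjacent : ∀ {x y} → x ∈ₛ S → y ∈ₛ S → hamming (label x) (label y) ≡ 1 →
                     adj G x y ≡ true
    label-adjacent {x} {y} x∈S y∈S h≡1 with adj G x y | proj₂ (pair-condition x∈S y∈S)
    ... | true  | _         = refl
    ... | false | condition = contradiction (subst (λ h → not (h ≡ᵇ 1) ≡ true) h≡1 condition) λ ()

    length-allWords≡length-members : length (allWords k) ≡ length (members S)
    length-allWords≡length-members = trans (length-allWords k) (sym (trans (length-members S) card≡2^k))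

    -- Opaque, like direction-exists below: unfolding these witnesses makes unification diverge.
    opaque
      label-onto : ∀ w → ∃[ x ] x ∈ₛ S × label x ≡ w
      label-onto w
        with x , x∈ , lx≡w ← injectiveOn⇒surjective (≡-dec Bool._≟_) label (members-unique S)
                                (λ p q → label-injective (∈-members⁻ S p) (∈-members⁻ S q))
                                (λ _ → allWords-complete _) (≤-reflexive length-allWords≡length-members)
                                (allWords-complete w) =
        x , ∈-members⁻ S x∈ , lx≡w

    vertex : Vec Bool k → Fin (n G)
    vertex w = proj₁ (label-onto w)

    vertex∈S : ∀ w → vertex w ∈ₛ S
    vertex∈S w = proj₁ (proj₂ (label-onto w))

    label-vertex : ∀ w → label (vertex w) ≡ w
    label-vertex w = proj₂ (proj₂ (label-onto w))

    vertex-label : ∀ {x} → x ∈ₛ S → vertex (label x) ≡ x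
    vertex-label x∈S = label-injective (vertex∈S _) x∈S (label-vertex _)

    dist-vertex : ∀ {w w′} → hamming w w′ ≡ 1 → dist (vertex w) (vertex w′) ≡ 1
    dist-vertex {w} {w′} h≡1 = adj⇒dist≡1 (label-adjacent (vertex∈S w) (vertex∈S w′)
      (subst₂ (λ a b → hamming a b ≡ 1) (sym (label-vertex w)) (sym (label-vertex w′)) h≡1))

    module Frame {v : Fin (n G)} (v∈S : v ∈ₛ S) where

      neighbour : Fin k → Fin (n G)
      neighbour i = vertex (toggle (label v) i)

      opaque
        direction-exists : ∀ i → ∃[ j ] f (neighbour i) ≡ toggle (f v) j
        direction-exists i = hamming≡1⇒toggle (f v) (f (neighbour i)) dist≡1
          where
          dist≡1 : dist v (neighbour i) ≡ 1
          dist≡1 = subst (λ x → dist x (neighbour i) ≡ 1) (vertex-label v∈S)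
                         (dist-vertex (hamming-toggle (label v) i))

      direction : Fin k → Fin m
      direction i = proj₁ (direction-exists i)

      f-neighbour : ∀ i → f (neighbour i) ≡ toggle (f v) (direction i)
      f-neighbour i = proj₂ (direction-exists i)

      direction-injective : ∀ {i i′} → direction i ≡ direction i′ → i ≡ i′
      direction-injective {i} {i′} eq = toggle-injectiveʳ (label v) (begin
        toggle (label v) i          ≡⟨ label-vertex _ ⟨
        label (neighbour i)         ≡⟨ cong label (f-injective f-neighbours) ⟩
        label (neighbour i′)        ≡⟨ label-vertex _ ⟩
        toggle (label v) i′         ∎)
        where
        open ≡-Reasoning
        f-neighbours : f (neighbour i) ≡ f (neighbour i′)
        f-neighbours = trans (f-neighbour i) (trans (cong (toggle (f v)) eq) (sym (f-neighbour i′)))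

      Direction : Fin m → Set
      Direction j = ∃[ i ] direction i ≡ j

      direction? : ∀ j → Dec (Direction j)
      direction? j = Finₚ.any? (λ i → direction i Finₚ.≟ j)

      offset : Vec Bool k → ∀ j → Dec (Direction j) → Bool
      offset w _ (yes (i , _)) = lookup w i xor lookup (label v) i
      offset w _ (no _)        = false

      -- The affine embedding of Q_k into Q_m mapping label v to f v and flips of coordinate i to
      -- flips of coordinate direction i.
      embed : Vec Bool k → Vec Bool m
      embed w = tabulate λ j → lookup (f v) j xor offset w j (direction? j)

      lookup-embed : ∀ w j → lookup (embed w) j ≡ lookup (f v) j xor offset w j (direction? j)
      lookup-embed w j = lookup∘tabulate _ j

      offset-direction : ∀ w i (d : Dec (Direction (direction i))) →
                         offset w (direction i) d ≡ lookup w i xor lookup (label v) i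
      offset-direction w i (yes (i′ , eq)) rewrite direction-injective eq = refl
      offset-direction w i (no ¬dir)       = contradiction (i , refl) ¬dir

      offset-outside : ∀ w {j} → ¬ Direction j → (d : Dec (Direction j)) → offset w j d ≡ false
      offset-outside w ¬dir (yes dir) = contradiction dir ¬dir
      offset-outside w ¬dir (no _)    = refl

      offset-toggle-≢ : ∀ w i {j} → j ≢ direction i → (d : Dec (Direction j)) →
                        offset (toggle w i) j d ≡ offset w j d
      offset-toggle-≢ w i j≢ (yes (i′ , refl)) =
        cong (_xor lookup (label v) i′) (lookup-toggle-≢ w (j≢ ∘ cong direction))
      offset-toggle-≢ w i j≢ (no _)            = refl

      lookup-embed-direction : ∀ w i → lookup (embed w) (direction i) ≡
                               lookup (f v) (direction i) xor (lookup w i xor lookup (label v) i)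
      lookup-embed-direction w i = trans (lookup-embed w (direction i))
        (cong (lookup (f v) (direction i) xor_) (offset-direction w i (direction? (direction i))))

      lookup-embed-outside : ∀ w {j} → ¬ Direction j → lookup (embed w) j ≡ lookup (f v) j
      lookup-embed-outside w {j} ¬dir =
        trans (lookup-embed w j)
              (trans (cong (lookup (f v) j xor_) (offset-outside w ¬dir (direction? j))) (xor-identityʳ _))

      embed-base : embed (label v) ≡ f v
      embed-base = pointwise⇒≡ λ j → trans (lookup-embed (label v) j) (base j (direction? j))
        where
        base : ∀ j (d : Dec (Direction j)) → lookup (f v) j xor offset (label v) j d ≡ lookup (f v) j
        base j (yes (i , _)) =
          trans (cong (lookup (f v) j xor_) (xor-same (lookup (label v) i))) (xor-identityʳ (lookup (f v) j))
        base j (no _)        = xor-identityʳ _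

      embed-toggle : ∀ w i → embed (toggle w i) ≡ toggle (embed w) (direction i)
      embed-toggle w i = pointwise⇒≡ coordinate
        where
        open ≡-Reasoning
        fᵥ ℓᵥ : Bool
        fᵥ = lookup (f v) (direction i)
        ℓᵥ = lookup (label v) i
        coordinate : ∀ j → lookup (embed (toggle w i)) j ≡ lookup (toggle (embed w) (direction i)) j
        coordinate j with j Finₚ.≟ direction i
        ... | yes refl = begin
          lookup (embed (toggle w i)) (direction i)  ≡⟨ lookup-embed-direction (toggle w i) i ⟩
          fᵥ xor (lookup (toggle w i) i xor ℓᵥ)      ≡⟨ cong (λ b → fᵥ xor (b xor ℓᵥ)) (lookup-toggle w i) ⟩
          fᵥ xor (not (lookup w i) xor ℓᵥ)           ≡⟨ xor-not-middle fᵥ (lookup w i) ℓᵥ ⟩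
          not (fᵥ xor (lookup w i xor ℓᵥ))           ≡⟨ cong not (lookup-embed-direction w i) ⟨
          not (lookup (embed w) (direction i))       ≡⟨ lookup-toggle (embed w) (direction i) ⟨
          lookup (toggle (embed w) (direction i)) (direction i) ∎
        ... | no j≢dᵢ = begin
          lookup (embed (toggle w i)) j
            ≡⟨ lookup-embed (toggle w i) j ⟩
          lookup (f v) j xor offset (toggle w i) j (direction? j)
            ≡⟨ cong (lookup (f v) j xor_) (offset-toggle-≢ w i j≢dᵢ (direction? j)) ⟩
          lookup (f v) j xor offset w j (direction? j)
            ≡⟨ lookup-embed w j ⟨
          lookup (embed w) j
            ≡⟨ lookup-toggle-≢ (embed w) j≢dᵢ ⟨
          lookup (toggle (embed w) (direction i)) j ∎

      embed-onto : ∀ p → (∀ {j} → lookup p j ≢ lookup (f v) j → Direction j) → ∃[ w ] embed w ≡ p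
      embed-onto p p-spanned = w , pointwise⇒≡ coordinate
        where
        w : Vec Bool k
        w = tabulate λ i → (lookup (f v) (direction i) xor lookup p (direction i)) xor lookup (label v) i
        coordinate : ∀ j → lookup (embed w) j ≡ lookup p j
        coordinate j with direction? j
        ... | yes (i , refl) = begin
          lookup (embed w) (direction i)       ≡⟨ lookup-embed-direction w i ⟩
          fᵥ xor (lookup w i xor ℓᵥ)           ≡⟨ cong (λ b → fᵥ xor (b xor ℓᵥ)) (lookup∘tabulate _ i) ⟩
          fᵥ xor (((fᵥ xor pᵥ) xor ℓᵥ) xor ℓᵥ) ≡⟨ cong (fᵥ xor_) (xor-cancelʳ (fᵥ xor pᵥ) ℓᵥ) ⟩
          fᵥ xor (fᵥ xor pᵥ)                   ≡⟨ xor-cancelˡ fᵥ pᵥ ⟩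
          pᵥ                                   ∎
          where
          open ≡-Reasoning
          fᵥ pᵥ ℓᵥ : Bool
          fᵥ = lookup (f v) (direction i)
          pᵥ = lookup p (direction i)
          ℓᵥ = lookup (label v) i
        ... | no ¬dir with lookup p j Bool.≟ lookup (f v) j
        ...   | yes pⱼ≡ = trans (lookup-embed-outside w ¬dir) (sym pⱼ≡)
        ...   | no  pⱼ≢ = contradiction (p-spanned pⱼ≢) ¬dir

      Agrees : Vec Bool k → Set
      Agrees w = f (vertex w) ≡ embed w

      agrees-base : Agrees (label v)
      agrees-base = trans (cong f (vertex-label v∈S)) (sym embed-base)

      agrees-neighbour : ∀ i → Agrees (toggle (label v) i)
      agrees-neighbour i = begin
        f (neighbour i)                        ≡⟨ f-neighbour i ⟩
        toggle (f v) (direction i)             ≡⟨ cong (λ p → toggle p (direction i)) embed-base ⟨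
        toggle (embed (label v)) (direction i) ≡⟨ embed-toggle (label v) i ⟨
        embed (toggle (label v) i)             ∎
        where open ≡-Reasoning

      -- f (vertex w) is a common neighbour of embed wᵢ and embed wⱼ (wᵢ, wⱼ: w with coordinate i resp. j
      -- flipped); the only other one, embed wᵢⱼ, is already the image of vertex wᵢⱼ ≠ vertex w.
      agrees-square : ∀ {e} w → hamming (label v) w ≡ suc (suc e) →
                      (∀ w′ → hamming (label v) w′ ≡ suc e → Agrees w′) →
                      (∀ w′ → hamming (label v) w′ ≡ e → Agrees w′) → Agrees w
      agrees-square {e} w h agrees₁ agrees₀
        with i , j , i≢j , vᵢ≢wᵢ , vⱼ≢wⱼ ← hamming≡2+⇒two-disagreements (label v) w h
        with common-neighbours (embed w) (f (vertex w)) (i≢j ∘ direction-injective)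
               (adjacent-to i vᵢ≢wᵢ) (adjacent-to j vⱼ≢wⱼ)
        where
        adjacent-to : ∀ l → lookup (label v) l ≢ lookup w l →
                      hamming (f (vertex w)) (toggle (embed w) (direction l)) ≡ 1
        adjacent-to l vₗ≢wₗ = begin
          hamming (f (vertex w)) (toggle (embed w) (direction l))
            ≡⟨ cong (hamming (f (vertex w))) (embed-toggle w l) ⟨
          hamming (f (vertex w)) (embed (toggle w l))
            ≡⟨ cong (hamming (f (vertex w))) (agrees₁ (toggle w l) closer) ⟨
          dist (vertex w) (vertex (toggle w l))
            ≡⟨ dist-vertex (hamming-toggle w l) ⟩
          1 ∎
          where
          open ≡-Reasoning
          closer : hamming (label v) (toggle w l) ≡ suc e
          closer = suc-injective (trans (hamming-toggle-≢ (label v) w vₗ≢wₗ) h)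
      ... | inj₁ fx≡P  = fx≡P
      ... | inj₂ fx≡P′ = contradiction (label-vertex w) label≢w
        where
        open ≡-Reasoning
        wᵢ wᵢⱼ : Vec Bool k
        wᵢ  = toggle w i
        wᵢⱼ = toggle wᵢ j
        wᵢ-closer : hamming (label v) wᵢ ≡ suc e
        wᵢ-closer = suc-injective (trans (hamming-toggle-≢ (label v) w vᵢ≢wᵢ) h)
        vⱼ≢wᵢⱼ : lookup (label v) j ≢ lookup wᵢ j
        vⱼ≢wᵢⱼ = subst (lookup (label v) j ≢_) (sym (lookup-toggle-≢ w (i≢j ∘ sym))) vⱼ≢wⱼ
        wᵢⱼ-closer : hamming (label v) wᵢⱼ ≡ e
        wᵢⱼ-closer = suc-injective (trans (hamming-toggle-≢ (label v) wᵢ vⱼ≢wᵢⱼ) wᵢ-closer)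
        vertex-w≡vertex-wᵢⱼ : vertex w ≡ vertex wᵢⱼ
        vertex-w≡vertex-wᵢⱼ = f-injective (begin
          f (vertex w)                                          ≡⟨ fx≡P′ ⟩
          toggle (toggle (embed w) (direction i)) (direction j)
            ≡⟨ cong (λ p → toggle p (direction j)) (embed-toggle w i) ⟨
          toggle (embed wᵢ) (direction j)                       ≡⟨ embed-toggle wᵢ j ⟨
          embed wᵢⱼ                                             ≡⟨ agrees₀ wᵢⱼ wᵢⱼ-closer ⟨
          f (vertex wᵢⱼ)                                        ∎)
        label≢w : label (vertex w) ≢ w
        label≢w eq = not-¬ refl (begin
          lookup w i                    ≡⟨ cong (λ x → lookup x i) eq ⟨
          lookup (label (vertex w)) i   ≡⟨ cong (λ x → lookup (label x) i) vertex-w≡vertex-wᵢⱼ ⟩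
          lookup (label (vertex wᵢⱼ)) i ≡⟨ cong (λ x → lookup x i) (label-vertex wᵢⱼ) ⟩
          lookup wᵢⱼ i                  ≡⟨ lookup-toggle-≢ wᵢ i≢j ⟩
          lookup wᵢ i                   ≡⟨ lookup-toggle w i ⟩
          not (lookup w i)              ∎)

      f∘vertex : ∀ w → f (vertex w) ≡ embed w
      f∘vertex w = agrees (hamming (label v) w) w refl
        where
        agrees : ∀ e w → hamming (label v) w ≡ e → Agrees w
        agrees zero          w h with refl ← hamming≡0⇒≡ (label v) w h = agrees-base
        agrees (suc zero)    w h with i , refl ← hamming≡1⇒toggle (label v) w h = agrees-neighbour i
        agrees (suc (suc e)) w h = agrees-square w h (agrees (suc e)) (agrees e)

      f-on-S : ∀ {x} → x ∈ₛ S → f x ≡ embed (label x)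
      f-on-S {x} x∈S = subst (λ y → f y ≡ embed (label x)) (vertex-label x∈S) (f∘vertex (label x))

      ∈-directions⇔ : ∀ {j} → j ∈ₛ directions S v ⇔ Direction j
      ∈-directions⇔ {j} = mk⇔ ∈⇒direction (λ { (i , refl) → direction∈ i })
        where
        ∈⇒direction : j ∈ₛ directions S v → Direction j
        ∈⇒direction j∈ with x , x∈S , j∈fx⊕fv ← ∈-directions⁻ {S} {v} j∈ with direction? j
        ... | yes dir  = dir
        ... | no  ¬dir = contradiction
          (trans (cong (λ p → lookup p j) (f-on-S x∈S)) (lookup-embed-outside (label x) ¬dir))
          (∈-⊕⁻ (f x) (f v) j∈fx⊕fv)
        direction∈ : ∀ i → direction i ∈ₛ directions S v
        direction∈ i = ∈-directions⁺ {S} (vertex∈S (toggle (label v) i)) (∈-⊕⁺ (f (neighbour i)) (f v)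
          (subst (λ p → lookup p (direction i) ≢ lookup (f v) (direction i)) (sym (f-neighbour i))
                 (toggle-changes (f v) (direction i))))

      card-directions : card (directions S v) ≡ k
      card-directions = card-injective-image {W = directions S v} direction direction-injective ∈-directions⇔

      directions⊆separating : ∀ u → (∀ {x} → x ∈ₛ S → dist u x ≤ dist u v) → directions S v ⊆ₛ f u ⊕ f v
      directions⊆separating u v-farthest j∈ with i , refl ← ∈-directions⇔ .to j∈
        with lookup (f u) (direction i) Bool.≟ lookup (f v) (direction i)
      ... | no  differ = ∈-⊕⁺ (f u) (f v) differ
      ... | yes same   = contradiction (v-farthest (vertex∈S _)) (<⇒≱ (≤-reflexive (sym further)))
        where
        further : dist u (neighbour i) ≡ suc (dist u v)
        further = trans (cong (hamming (f u)) (f-neighbour i)) (hamming-toggle-≡ (f u) (f v) same)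

      ∈ₛ⇔⊆directions : ∀ {x} → x ∈ₛ S ⇔ (f x ⊕ f v ⊆ₛ directions S v)
      ∈ₛ⇔⊆directions {x} = mk⇔ (λ x∈S {j} → ∈-directions⁺ {S} {x} {v} {j} x∈S) spanned⇒∈
        where
        spanned⇒∈ : f x ⊕ f v ⊆ₛ directions S v → x ∈ₛ S
        spanned⇒∈ spanned
          with w , embed-w≡fx ← embed-onto (f x)
                                  (λ differ → ∈-directions⇔ .to (spanned (∈-⊕⁺ (f x) (f v) differ))) =
          subst (_∈ₛ S) (f-injective (trans (f∘vertex w) embed-w≡fx)) (vertex∈S w)

  module Counting (u : Fin (n G)) (k : ℕ) where

    -- The default u is never used: induced cubes are nonempty.
    farthestIn : List (Fin (n G)) → Fin (n G)
    farthestIn []       = u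
    farthestIn (x ∷ xs) = argmax (dist u) x xs

    farthestIn-∈ : ∀ x xs → farthestIn (x ∷ xs) ∈ x ∷ xs
    farthestIn-∈ x xs with argmax-sel (dist u) x xs
    ... | inj₁ ≡x  = here ≡x
    ... | inj₂ ∈xs = there ∈xs

    farthestIn-max : ∀ {y} xs → y ∈ xs → dist u y ≤ dist u (farthestIn xs)
    farthestIn-max (x ∷ xs) (here refl)  = f[⊥]≤f[argmax] {f = dist u} x xs
    farthestIn-max (x ∷ xs) (there y∈xs) = All.lookup (f[xs]≤f[argmax] {f = dist u} x xs) y∈xs

    farthest : Vec Bool (n G) → Fin (n G)
    farthest S = farthestIn (members S)

    farthest-∈ₛ : ∀ S → 0 < card S → farthest S ∈ₛ S
    farthest-∈ₛ S 0<|S| with members S | ∈-members⁻ S | length-members S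
    ... | []     | _          | 0≡|S| = contradiction 0≡|S| (<⇒≢ 0<|S|)
    ... | x ∷ xs | ∈-members⇒ | _     = ∈-members⇒ (farthestIn-∈ x xs)

    farthest-max : ∀ {S x} → x ∈ₛ S → dist u x ≤ dist u (farthest S)
    farthest-max {S} x∈S = farthestIn-max (members S) (∈-members⁺ S x∈S)

    signature : Vec Bool (n G) → Fin (n G) × Vec Bool m
    signature S = farthest S , directions S (farthest S)

    cubes : List (Vec Bool (n G))
    cubes = filter (λ S → inducesCube G k S Bool.≟ true) (allWords (n G))

    cube-iso : ∀ {S} → S ∈ cubes → ∃[ φ ] isCubeIso G k S φ ≡ true
    cube-iso {S} S∈
      with φ , _ , iso ← any-≡true⁻ (isCubeIso G k S) (allVecsOver (allWords k) (n G))
                           (proj₂ (∈-filter⁻ (λ S → inducesCube G k S Bool.≟ true) {xs = allWords (n G)} S∈)) =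
      φ , iso

    sphere : ℕ → List (Fin (n G))
    sphere d = filter (λ v → atDist G u v d Bool.≟ true) (allFin (n G))

    signaturesAt : Fin (n G) → List (Fin (n G) × Vec Bool m)
    signaturesAt v = map (v ,_) (subsetsOfSize (f u ⊕ f v) k)

    signatures : List (Fin (n G) × Vec Bool m)
    signatures = concatMap (λ d → concatMap signaturesAt (sphere d)) (upTo (suc (n G)))

    module FarthestFrame {S} (S∈ : S ∈ cubes) where
      open InducedCube {k} {S} {proj₁ (cube-iso S∈)} (proj₂ (cube-iso S∈)) public
      open Frame (farthest-∈ₛ S (subst (0 <_) (sym card≡2^k) (m^n>0 2 k))) public

    signature∈signatures : ∀ {S} → S ∈ cubes → signature S ∈ signatures
    signature∈signatures {S} S∈ =
      ∈-concatMap⁺ (λ d → concatMap signaturesAt (sphere d)) (lose (∈-upTo⁺ (m<n⇒m<1+n (dist<n u v)))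
        (∈-concatMap⁺ signaturesAt
          (lose (∈-filter⁺ (λ x → atDist G u x (dist u v) Bool.≟ true) (∈-allFin v) (isometric u v))
                (∈-map⁺ (v ,_) directions∈))))
      where
      open FarthestFrame S∈
      v : Fin (n G)
      v = farthest S
      directions∈ : directions S v ∈ subsetsOfSize (f u ⊕ f v) k
      directions∈ = subst (λ c → directions S v ∈ subsetsOfSize (f u ⊕ f v) c) card-directions
                      (∈-subsetsOfSize {W = directions S v} {f u ⊕ f v} (directions⊆separating u (farthest-max {S})))

    signature-injective : InjectiveOn signature cubes
    signature-injective S₁∈ S₂∈ sig≡ =
      ⊆ₛ-antisym (transfer S₁∈ S₂∈ sig≡) (transfer S₂∈ S₁∈ (sym sig≡))
      where
      transfer : ∀ {S S′} → S ∈ cubes → S′ ∈ cubes → signature S ≡ signature S′ → S ⊆ₛ S′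
      transfer S∈ S′∈ sig≡ {x} x∈S = FarthestFrame.∈ₛ⇔⊆directions S′∈ .from
        (subst (λ σ → f x ⊕ f (proj₁ σ) ⊆ₛ proj₂ σ) sig≡
               (FarthestFrame.∈ₛ⇔⊆directions S∈ .to x∈S))

    length-signatures : length signatures ≡ shiftedWienerCoeff G u k
    length-signatures =
      trans (length-concatMap (λ d → concatMap signaturesAt (sphere d)) (upTo (suc (n G))))
            (cong sum (map-cong length-shell (upTo (suc (n G)))))
      where
      length-shell : ∀ d → length (concatMap signaturesAt (sphere d)) ≡ distCount G u d * (d C k)
      length-shell d =
        trans (length-concatMap signaturesAt (sphere d)) (sum-map-const _ (sphere d) length-signaturesAt)
        where
        open ≡-Reasoning
        length-signaturesAt : ∀ {v} → v ∈ sphere d → length (signaturesAt v) ≡ d C k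
        length-signaturesAt {v} v∈ = begin
          length (signaturesAt v)              ≡⟨ length-map _ (subsetsOfSize (f u ⊕ f v) k) ⟩
          length (subsetsOfSize (f u ⊕ f v) k) ≡⟨ length-subsetsOfSize (f u ⊕ f v) k ⟩
          card (f u ⊕ f v) C k                 ≡⟨ cong (_C k) (card-⊕ (f u) (f v)) ⟩
          dist u v C k                         ≡⟨ cong (_C k) (atDist⇒≡dist d v-at-d) ⟨
          d C k                                ∎
          where
          v-at-d : atDist G u v d ≡ true
          v-at-d = proj₂ (∈-filter⁻ (λ x → atDist G u x d Bool.≟ true) {xs = allFin (n G)} v∈)

corollary1 : (G : Graph) → IsPartialCube G → (u : Fin (n G)) →
    (k : ℕ) → cubeCoeff G k ≤ shiftedWienerCoeff G u k
corollary1 G (_ , f , isometric) u k = begin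
  cubeCoeff G k
    ≡⟨⟩
  length cubes
    ≤⟨ injectiveOn⇒length≤ signature cubes-unique signature-injective signature∈signatures ⟩
  length signatures
    ≡⟨ length-signatures ⟩
  shiftedWienerCoeff G u k ∎
  where
  open PartialCube f isometric
  open Counting u k
  open ≤-Reasoning
  cubes-unique : Unique cubes
  cubes-unique = Unique.filter⁺ _ (allWords-unique (n G))
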